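{- Let $p$ be a prime. For every integer $n\ge1$, $$\int_{\mathbb{Z}_p}x\binom{x-2}{n-1}\,d\mu_1(x)=(-1)^n\sum_{k=1}^{n}\frac{k}{k+1}.$$
   Context: The Volkenborn integral of a polynomial function $f:\mathbb{Z}_p\to\mathbb{Q}_p$ is $\int_{\mathbb{Z}_p}f(x)\,d\mu_1(x)=\lim_{N\to\infty}p^{ -N}\sum_{x=0}^{p^N-1}f(x)$. For a variable $y$ and integer $m\ge0$, $\binom{y}{m}=\frac{y(y-1)\cdots(y-m+1)}{m!}$ is the binomial polynomial. -}

module Defs where

open import Data.Nat as ℕ using (ℕ; zero; suc; _≤_; _^_; NonZero; _!)
open import Data.Nat.Properties using (m^n≢0; _!≢0)
open import Data.Nat.Divisibility using (_∣_)
open import Data.Nat.Primality using (Prime; prime⇒nonZero)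
open import Data.Integer as ℤ using (ℤ; +_; ∣_∣)
open import Data.Rational as ℚ using (ℚ; _/_; ↥_; _+_; _*_; _-_; 0ℚ; 1ℚ)
open import Data.Product using (∃)

falling : ℤ → ℕ → ℤ
falling y zero    = + 1
falling y (suc m) = falling y m ℤ.* (y ℤ.- + m)

binom : ℤ → ℕ → ℚ
binom y m = _/_ (falling y m) (m !) {{m !≢0}}

sumBelow : (ℕ → ℚ) → ℕ → ℚ
sumBelow f zero    = 0ℚ
sumBelow f (suc M) = sumBelow f M + f M

volkenbornSum : (p : ℕ) → Prime p → (ℕ → ℚ) → ℕ → ℚ
volkenbornSum p pr f N =
  sumBelow f (p ^ N) * _/_ (+ 1) (p ^ N) {{m^n≢0 p N {{prime⇒nonZero pr}}}}

-- p-adic "v_p(r) ≥ k" for a rational r (in lowest terms), k ≥ 1: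
-- p^k divides the numerator of r (then p does not divide the denominator).
padicValGe : ℕ → ℕ → ℚ → Set
padicValGe p k r = (p ^ k) ∣ ∣ ↥ r ∣

PAdicLimit : ℕ → (ℕ → ℚ) → ℚ → Set
PAdicLimit p a L =
  ∀ (k : ℕ) → ∃ λ N₀ → ∀ (N : ℕ) → N₀ ≤ N → padicValGe p (suc k) (a N ℚ.- L)

VolkenbornIntegral≡ : (p : ℕ) → Prime p → (ℕ → ℚ) → ℚ → Set
VolkenbornIntegral≡ p pr f L = PAdicLimit p (volkenbornSum p pr f) L

integrand : ℕ → ℕ → ℚ
integrand n x = (+ x / 1) * binom (+ x ℤ.- + 2) (n ℕ.∸ 1)

signQ : ℕ → ℚ
signQ zero    = 1ℚ
signQ (suc n) = ℚ.- signQ n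

rhsSum : ℕ → ℚ
rhsSum zero    = 0ℚ
rhsSum (suc n) = rhsSum n + (+ suc n / suc (suc n))

{-# OPTIONS --safe #-}

-- Up to the factor D = (n + 1)!, the integrand x · binom (x − 2) (n − 1) is the forward difference of an
-- integer polynomial U, a combination of falling factorials of x − 2. So the Riemann sums telescope:
-- D · p^-N · Σ_{x<p^N} f x = (U (p^N) − U 0) / p^N ≡ U′(0) modulo p^N, and U′(0), computed from the
-- derivatives of falling factorials at −2, equals D · (−1)^n · Σ_{k=1}^{n} k/(k+1). Dividing by D costs at
-- most D powers of p, so the sums converge p-adically.
module Submission where

open import Defs

module IntegerPolynomials where
  open import Data.Nat as ℕ using (ℕ; zero; suc; _!)
  open import Data.Integer using (ℤ; +_; _+_; _-_; _*_; -_; -1ℤ; _^_)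
  open import Data.Integer.Properties using (pos-*; *-identityʳ)
  open import Data.Integer.Tactic.RingSolver using (solve-∀)
  open import Data.Product using (∃; _,_)
  open import Relation.Binary.PropositionalEquality

  record HasSlopeAt (f : ℤ → ℤ) (c d : ℤ) : Set where
    constructor slope
    field expansion : ∀ h → ∃ λ w → f (c + h) ≡ f c + h * d + h * h * w

  slope-const : ∀ a c → HasSlopeAt (λ _ → a) c (+ 0)
  slope-const a c = slope λ h → + 0 , constant a h
    where
    constant : ∀ a h → a ≡ a + h * + 0 + h * h * + 0
    constant = solve-∀

  slope-linear : ∀ a c → HasSlopeAt (λ y → y - a) c (+ 1)
  slope-linear a c = slope λ h → + 0 , linear a c h
    where
    linear : ∀ a c h → c + h - a ≡ c - a + h * + 1 + h * h * + 0
    linear = solve-∀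

  slope-translate : ∀ {f c d} t → HasSlopeAt f (c + t) d → HasSlopeAt (λ x → f (x + t)) c d
  slope-translate {f} {c} t (slope f′) = slope λ h → let w , eq = f′ h in w , trans (cong f (swap c h t)) eq
    where
    swap : ∀ c h t → c + h + t ≡ c + t + h
    swap = solve-∀

  slope-scale : ∀ {f c d} a → HasSlopeAt f c d → HasSlopeAt (λ y → a * f y) c (a * d)
  slope-scale {f} {c} {d} a (slope f′) = slope λ h → let w , eq = f′ h in
    a * w , trans (cong (a *_) eq) (distribute a (f c) h d w)
    where
    distribute : ∀ a F h d w → a * (F + h * d + h * h * w) ≡ a * F + h * (a * d) + h * h * (a * w)
    distribute = solve-∀

  slope-+ : ∀ {f g c d e} → HasSlopeAt f c d → HasSlopeAt g c e → HasSlopeAt (λ y → f y + g y) c (d + e)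
  slope-+ {f} {g} {c} {d} {e} (slope f′) (slope g′) = slope λ h → let w₁ , eq₁ = f′ h; w₂ , eq₂ = g′ h in
    w₁ + w₂ , trans (cong₂ _+_ eq₁ eq₂) (regroup (f c) (g c) h d e w₁ w₂)
    where
    regroup : ∀ F G h d e w₁ w₂ →
              (F + h * d + h * h * w₁) + (G + h * e + h * h * w₂) ≡ F + G + h * (d + e) + h * h * (w₁ + w₂)
    regroup = solve-∀

  slope-* : ∀ {f g c d e} → HasSlopeAt f c d → HasSlopeAt g c e → HasSlopeAt (λ y → f y * g y) c (f c * e + d * g c)
  slope-* {f} {g} {c} {d} {e} (slope f′) (slope g′) = slope λ h → let w₁ , eq₁ = f′ h; w₂ , eq₂ = g′ h in
    f c * w₂ + d * e + w₁ * g c + h * (d * w₂ + w₁ * e) + h * h * w₁ * w₂ ,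
    trans (cong₂ _*_ eq₁ eq₂) (expand (f c) (g c) h d e w₁ w₂)
    where
    expand : ∀ F G h d e w₁ w₂ → (F + h * d + h * h * w₁) * (G + h * e + h * h * w₂) ≡
             F * G + h * (F * e + d * G) + h * h * (F * w₂ + d * e + w₁ * G + h * (d * w₂ + w₁ * e) + h * h * w₁ * w₂)
    expand = solve-∀

  pos-! : ∀ k → + (suc k !) ≡ + suc k * + (k !)
  pos-! k = pos-* (suc k) (k !)

  falling′ : ℤ → ℕ → ℤ
  falling′ c zero    = + 0
  falling′ c (suc k) = falling c k + falling′ c k * (c - + k)

  falling-slope : ∀ c k → HasSlopeAt (λ y → falling y k) c (falling′ c k)
  falling-slope c zero    = slope-const (+ 1) c
  falling-slope c (suc k) =
    subst (HasSlopeAt (λ y → falling y (suc k)) c) (cong (_+ falling′ c k * (c - + k)) (*-identityʳ (falling c k)))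
          (slope-* (falling-slope c k) (slope-linear (+ k) c))

  falling-shift : ∀ y k → falling (y + + 1) (suc k) ≡ (y + + 1) * falling y k
  falling-shift y zero    = commute y
    where
    commute : ∀ y → + 1 * (y + + 1 - + 0) ≡ (y + + 1) * + 1
    commute = solve-∀
  falling-shift y (suc k) = begin
    falling (y + + 1) (suc k) * (y + + 1 - + suc k) ≡⟨ cong (_* (y + + 1 - + suc k)) (falling-shift y k) ⟩
    (y + + 1) * falling y k * (y + + 1 - + suc k)   ≡⟨ reassociate y (+ k) (falling y k) ⟩
    (y + + 1) * (falling y k * (y - + k))           ∎
    where
    open ≡-Reasoning
    reassociate : ∀ y k F → (y + + 1) * F * (y + + 1 - (+ 1 + k)) ≡ (y + + 1) * (F * (y - k))
    reassociate = solve-∀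

  -- Found from Δ falling y (k + 1) = (k + 1) · falling y k and
  -- x · falling y m = falling y (m + 1) + (m + 2) · falling y m, where y = x − 2.
  antiderivative : ℕ → ℤ → ℤ
  antiderivative m x = + suc m * falling (x - + 2) (2 ℕ.+ m) + + (2 ℕ.+ m) * + (2 ℕ.+ m) * falling (x - + 2) (suc m)

  antiderivative-Δ : ∀ m x → antiderivative m (+ 1 + x) - antiderivative m x ≡ + suc m * + (2 ℕ.+ m) * (x * falling (x - + 2) m)
  antiderivative-Δ m x = begin
    U (+ 1 + x) - U x
      ≡⟨ cong₂ (λ u v → + suc m * u + + (2 ℕ.+ m) * + (2 ℕ.+ m) * v - U x) (shifted (suc m)) (shifted m) ⟩
    + suc m * ((y + + 1) * falling y (suc m)) + + (2 ℕ.+ m) * + (2 ℕ.+ m) * ((y + + 1) * falling y m) - U x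
      ≡⟨ collect x (+ m) (falling y m) ⟩
    + suc m * + (2 ℕ.+ m) * (x * falling y m) ∎
    where
    open ≡-Reasoning
    U = antiderivative m
    y = x - + 2
    shifted : ∀ k → falling (+ 1 + x - + 2) (suc k) ≡ (y + + 1) * falling y k
    shifted k = trans (cong (λ z → falling z (suc k)) (commute x)) (falling-shift y k)
      where
      commute : ∀ x → + 1 + x - + 2 ≡ x - + 2 + + 1
      commute = solve-∀
    collect : ∀ x m F →
      (+ 1 + m) * ((x - + 2 + + 1) * (F * (x - + 2 - m))) + (+ 2 + m) * (+ 2 + m) * ((x - + 2 + + 1) * F)
        - ((+ 1 + m) * (F * (x - + 2 - m) * (x - + 2 - (+ 1 + m))) + (+ 2 + m) * (+ 2 + m) * (F * (x - + 2 - m)))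
        ≡ (+ 1 + m) * (+ 2 + m) * (x * F)
    collect = solve-∀

  -- (n + 1)! · rhsSum n
  scaledRhsSum : ℕ → ℤ
  scaledRhsSum zero    = + 0
  scaledRhsSum (suc k) = scaledRhsSum k * + (2 ℕ.+ k) + + suc k * + (suc k !)

  falling[-2] : ∀ k → falling (- + 2) k ≡ -1ℤ ^ k * + (suc k !)
  falling[-2] zero    = refl
  falling[-2] (suc k) = begin
    falling (- + 2) k * (- + 2 - + k)          ≡⟨ cong (_* (- + 2 - + k)) (falling[-2] k) ⟩
    -1ℤ ^ k * + (suc k !) * (- + 2 - + k)      ≡⟨ collect (-1ℤ ^ k) (+ k) (+ (suc k !)) ⟩
    -1ℤ ^ suc k * (+ (2 ℕ.+ k) * + (suc k !))  ≡⟨ cong (-1ℤ ^ suc k *_) (pos-! (suc k)) ⟨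
    -1ℤ ^ suc k * + (suc (suc k) !)            ∎
    where
    open ≡-Reasoning
    collect : ∀ s k P → s * P * (- + 2 - k) ≡ -1ℤ * s * ((+ 2 + k) * P)
    collect = solve-∀

  falling′[-2] : ∀ k → falling′ (- + 2) k ≡ -1ℤ ^ k * (scaledRhsSum k - + k * + (suc k !))
  falling′[-2] zero    = refl
  falling′[-2] (suc k) = begin
    falling (- + 2) k + falling′ (- + 2) k * (- + 2 - + k)
      ≡⟨ cong₂ (λ u v → u + v * (- + 2 - + k)) (falling[-2] k) (falling′[-2] k) ⟩
    -1ℤ ^ k * P + -1ℤ ^ k * (scaledRhsSum k - + k * P) * (- + 2 - + k)
      ≡⟨ collect (-1ℤ ^ k) (scaledRhsSum k) (+ k) P ⟩
    -1ℤ ^ suc k * (scaledRhsSum (suc k) - + suc k * (+ (2 ℕ.+ k) * P))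
      ≡⟨ cong (λ Q → -1ℤ ^ suc k * (scaledRhsSum (suc k) - + suc k * Q)) (pos-! (suc k)) ⟨
    -1ℤ ^ suc k * (scaledRhsSum (suc k) - + suc k * + (suc (suc k) !)) ∎
    where
    open ≡-Reasoning
    P = + (suc k !)
    collect : ∀ s R k P → s * P + s * (R - k * P) * (- + 2 - k) ≡
              -1ℤ * s * (R * (+ 2 + k) + (+ 1 + k) * P - (+ 1 + k) * ((+ 2 + k) * P))
    collect = solve-∀

  antiderivative-slope : ∀ m → HasSlopeAt (antiderivative m) (+ 0) (-1ℤ ^ suc m * scaledRhsSum (suc m))
  antiderivative-slope m = subst (HasSlopeAt (antiderivative m) (+ 0)) derivative (slope-+ leading lower)
    where
    a = + suc m
    b = + (2 ℕ.+ m) * + (2 ℕ.+ m)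
    leading : HasSlopeAt (λ x → a * falling (x - + 2) (2 ℕ.+ m)) (+ 0) (a * falling′ (- + 2) (2 ℕ.+ m))
    leading = slope-scale a (slope-translate (- + 2) (falling-slope (- + 2) (2 ℕ.+ m)))
    lower : HasSlopeAt (λ x → b * falling (x - + 2) (suc m)) (+ 0) (b * falling′ (- + 2) (suc m))
    lower = slope-scale b (slope-translate (- + 2) (falling-slope (- + 2) (suc m)))
    derivative : a * falling′ (- + 2) (2 ℕ.+ m) + b * falling′ (- + 2) (suc m) ≡ -1ℤ ^ suc m * scaledRhsSum (suc m)
    derivative = begin
      a * falling′ (- + 2) (2 ℕ.+ m) + b * falling′ (- + 2) (suc m)
        ≡⟨ cong₂ (λ u v → a * u + b * v) (falling′[-2] (2 ℕ.+ m)) (falling′[-2] (suc m)) ⟩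
      a * (-1ℤ * s * (R * + (3 ℕ.+ m) + + (2 ℕ.+ m) * P - + (2 ℕ.+ m) * + ((3 ℕ.+ m) !))) + b * (s * (R - + suc m * P))
        ≡⟨ cong (λ Q → a * (-1ℤ * s * (R * + (3 ℕ.+ m) + + (2 ℕ.+ m) * P - + (2 ℕ.+ m) * Q)) + b * (s * (R - + suc m * P)))
                (pos-! (2 ℕ.+ m)) ⟩
      a * (-1ℤ * s * (R * + (3 ℕ.+ m) + + (2 ℕ.+ m) * P - + (2 ℕ.+ m) * (+ (3 ℕ.+ m) * P))) + b * (s * (R - + suc m * P))
        ≡⟨ cancel s R (+ m) P ⟩
      s * R ∎
      where
      open ≡-Reasoning
      s = -1ℤ ^ suc m
      R = scaledRhsSum (suc m)
      P = + ((2 ℕ.+ m) !)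
      cancel : ∀ s R m P →
        (+ 1 + m) * (-1ℤ * s * (R * (+ 3 + m) + (+ 2 + m) * P - (+ 2 + m) * ((+ 3 + m) * P)))
          + (+ 2 + m) * (+ 2 + m) * (s * (R - (+ 1 + m) * P)) ≡ s * R
      cancel = solve-∀

module PrimePowers where
  open import Data.Nat
  open import Data.Nat.Properties
  open import Data.Nat.Divisibility
  open import Data.Nat.Primality using (Prime; prime⇒nonZero; prime⇒nonTrivial; euclidsLemma)
  open import Data.Sum using (inj₁; inj₂)
  open import Relation.Nullary using (¬_; yes; no; contradiction)
  open import Relation.Binary.PropositionalEquality
  open import Data.Nat.Tactic.RingSolver using (solve-∀)

  ^-monoʳ-∣ : ∀ p {m n} → m ≤ n → p ^ m ∣ p ^ n
  ^-monoʳ-∣ p {m} {n} m≤n = divides (p ^ (n ∸ m)) (begin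
    p ^ n                ≡⟨ cong (p ^_) (m+[n∸m]≡n m≤n) ⟨
    p ^ (m + (n ∸ m))    ≡⟨ ^-distribˡ-+-* p m (n ∸ m) ⟩
    p ^ m * p ^ (n ∸ m)  ≡⟨ *-comm (p ^ m) _ ⟩
    p ^ (n ∸ m) * p ^ m  ∎)
    where open ≡-Reasoning

  n<m^n : ∀ {m} → 1 < m → ∀ n → n < m ^ n
  n<m^n 1<m zero    = z<s
  n<m^n {m} 1<m (suc n) = begin-strict
    suc n       ≤⟨ n<m^n 1<m n ⟩
    m ^ n       <⟨ m<m*n (m ^ n) m 1<m ⟩
    m ^ n * m   ≡⟨ *-comm (m ^ n) m ⟩
    m * m ^ n   ∎
    where
    open ≤-Reasoning
    instance _ = m^n≢0 m n {{>-nonZero (<-trans z<s 1<m)}}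

  module _ {p : ℕ} (p-prime : Prime p) where

    instance
      _ = prime⇒nonZero p-prime

    ^∣-*-cancelˡ : ∀ {a b} → ¬ p ∣ a → ∀ k → p ^ k ∣ a * b → p ^ k ∣ b
    ^∣-*-cancelˡ {b = b} p∤a zero    _    = 1∣ b
    ^∣-*-cancelˡ {a} {b} p∤a (suc k) pᵏ⁺¹∣ab with euclidsLemma a b p-prime (∣-trans (m∣m*n (p ^ k)) pᵏ⁺¹∣ab)
    ... | inj₁ p∣a              = contradiction p∣a p∤a
    ... | inj₂ (divides q refl) = subst (_∣ q * p) (*-comm (p ^ k) p) (*-monoˡ-∣ p pᵏ∣q)
      where
      pᵏ∣q : p ^ k ∣ q
      pᵏ∣q = ^∣-*-cancelˡ p∤a k (*-cancelˡ-∣ p (subst (p * p ^ k ∣_) (rearrange a q p) pᵏ⁺¹∣ab))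
        where
        rearrange : ∀ a q p → a * (q * p) ≡ p * (a * q)
        rearrange = solve-∀

    -- p ^ y never divides y, so the factor y can absorb at most y powers of p.
    ^-+-∣-*-cancel : ∀ {y} .{{_ : NonZero y}} t x → p ^ (t + y) ∣ x * y → p ^ t ∣ x
    ^-+-∣-*-cancel zero    x _ = 1∣ x
    ^-+-∣-*-cancel {y} (suc t) x pᵗ⁺¹⁺ʸ∣xy with ^-+-∣-*-cancel t x (∣-trans (^-monoʳ-∣ p (n≤1+n (t + y))) pᵗ⁺¹⁺ʸ∣xy)
    ... | divides q refl with p ∣? q
    ...   | yes (divides r refl) = divides r (rearrange r p (p ^ t))
      where
      rearrange : ∀ r p pᵗ → r * p * pᵗ ≡ r * (p * pᵗ)
      rearrange = solve-∀
    ...   | no p∤q = contradiction (^∣-*-cancelˡ p∤q (suc y) pʸ⁺¹∣qy) (>⇒∤ y<pʸ⁺¹)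
      where
      y<pʸ⁺¹ : y < p ^ suc y
      y<pʸ⁺¹ = <-trans (n<1+n y) (n<m^n (nonTrivial⇒n>1 p {{prime⇒nonTrivial p-prime}}) (suc y))
      split : p ^ (suc t + y) ≡ p ^ t * p ^ suc y
      split = trans (cong (p ^_) (sym (+-suc t y))) (^-distribˡ-+-* p t (suc y))
      rearrange : ∀ q pᵗ y → q * pᵗ * y ≡ pᵗ * (q * y)
      rearrange = solve-∀
      pʸ⁺¹∣qy : p ^ suc y ∣ q * y
      pʸ⁺¹∣qy = *-cancelˡ-∣ (p ^ t) {{m^n≢0 p t}} (subst₂ _∣_ split (rearrange q (p ^ t) y) pᵗ⁺¹⁺ʸ∣xy)

open IntegerPolynomials
open PrimePowers

open import Data.Nat as ℕ using (ℕ; zero; suc; _!; _^_; _≤_; NonZero)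
import Data.Nat.Properties as ℕ
open import Data.Nat.Properties using (_!≢0; m^n≢0)
open import Data.Nat.Divisibility using (_∣_; ∣-trans; m∣m*n; ∣m⇒∣m*n)
open import Data.Nat.Primality using (Prime; prime⇒nonZero)
open import Data.Integer as ℤ using (ℤ; +_; -1ℤ)
import Data.Integer.Properties as ℤ
open import Data.Rational as ℚ using (ℚ; _/_; _+_; _*_; _-_; -_; 1ℚ; toℚᵘ; ↥_)
open import Data.Rational.Properties using (toℚᵘ-injective; toℚᵘ-fromℚᵘ; toℚᵘ-homo-+; toℚᵘ-homo-*; toℚᵘ-homo‿-; *-assoc; *-distribʳ-+; *-zeroˡ)
open import Data.Rational.Unnormalised as ℚᵘ using (mkℚᵘ; *≡*)
import Data.Rational.Unnormalised.Properties as ℚᵘ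
open import Data.Integer.Tactic.RingSolver using (solve-∀)
open import Data.Rational.Solver renaming (module +-*-Solver to ℚ-Solver)
open import Data.Product using (∃; _,_; proj₁; proj₂)
open import Relation.Binary.PropositionalEquality

ι : ℤ → ℚ
ι z = z / 1

toℚᵘ-ι : ∀ z → toℚᵘ (ι z) ℚᵘ.≃ mkℚᵘ z 0
toℚᵘ-ι z = toℚᵘ-fromℚᵘ (mkℚᵘ z 0)

ι-homo-+ : ∀ a b → ι (a ℤ.+ b) ≡ ι a + ι b
ι-homo-+ a b = toℚᵘ-injective (begin
  toℚᵘ (ι (a ℤ.+ b))             ≈⟨ toℚᵘ-ι (a ℤ.+ b) ⟩
  mkℚᵘ (a ℤ.+ b) 0               ≈⟨ *≡* (identity a b) ⟩
  mkℚᵘ a 0 ℚᵘ.+ mkℚᵘ b 0         ≈⟨ ℚᵘ.+-cong (toℚᵘ-ι a) (toℚᵘ-ι b) ⟨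
  toℚᵘ (ι a) ℚᵘ.+ toℚᵘ (ι b)     ≈⟨ toℚᵘ-homo-+ (ι a) (ι b) ⟨
  toℚᵘ (ι a + ι b)               ∎)
  where
  open ℚᵘ.≃-Reasoning
  identity : ∀ a b → (a ℤ.+ b) ℤ.* + 1 ≡ (a ℤ.* + 1 ℤ.+ b ℤ.* + 1) ℤ.* + 1
  identity = solve-∀

ι-homo-* : ∀ a b → ι (a ℤ.* b) ≡ ι a * ι b
ι-homo-* a b = toℚᵘ-injective (begin
  toℚᵘ (ι (a ℤ.* b))             ≈⟨ toℚᵘ-ι (a ℤ.* b) ⟩
  mkℚᵘ (a ℤ.* b) 0               ≈⟨ *≡* refl ⟩
  mkℚᵘ a 0 ℚᵘ.* mkℚᵘ b 0         ≈⟨ ℚᵘ.*-cong (toℚᵘ-ι a) (toℚᵘ-ι b) ⟨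
  toℚᵘ (ι a) ℚᵘ.* toℚᵘ (ι b)     ≈⟨ toℚᵘ-homo-* (ι a) (ι b) ⟨
  toℚᵘ (ι a * ι b)               ∎)
  where open ℚᵘ.≃-Reasoning

ι-homo‿- : ∀ a → ι (ℤ.- a) ≡ - ι a
ι-homo‿- a = toℚᵘ-injective (begin
  toℚᵘ (ι (ℤ.- a))   ≈⟨ toℚᵘ-ι (ℤ.- a) ⟩
  mkℚᵘ (ℤ.- a) 0     ≈⟨ ℚᵘ.-‿cong (toℚᵘ-ι a) ⟨
  ℚᵘ.- toℚᵘ (ι a)    ≈⟨ toℚᵘ-homo‿- (ι a) ⟨
  toℚᵘ (- ι a)       ∎)
  where open ℚᵘ.≃-Reasoning

/-*-ι : ∀ i n .{{_ : NonZero n}} → (i / n) * ι (+ n) ≡ ι i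
/-*-ι i n@(suc n-1) = toℚᵘ-injective (begin
  toℚᵘ ((i / n) * ι (+ n))            ≈⟨ toℚᵘ-homo-* (i / n) (ι (+ n)) ⟩
  toℚᵘ (i / n) ℚᵘ.* toℚᵘ (ι (+ n))    ≈⟨ ℚᵘ.*-cong (toℚᵘ-fromℚᵘ (mkℚᵘ i n-1)) (toℚᵘ-ι (+ n)) ⟩
  mkℚᵘ i n-1 ℚᵘ.* mkℚᵘ (+ n) 0        ≈⟨ *≡* cross ⟩
  mkℚᵘ i 0                            ≈⟨ toℚᵘ-ι i ⟨
  toℚᵘ (ι i)                          ∎)
  where
  open ℚᵘ.≃-Reasoning
  cross : i ℤ.* + n ℤ.* + 1 ≡ i ℤ.* + (suc (n-1 ℕ.* 1))
  cross = trans (ℤ.*-identityʳ (i ℤ.* + n)) (cong (λ k → i ℤ.* + suc k) (sym (ℕ.*-identityʳ n-1)))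

signQ-ι : ∀ n → signQ n ≡ ι (-1ℤ ℤ.^ n)
signQ-ι zero    = refl
signQ-ι (suc n) = begin
  - signQ n                 ≡⟨ cong -_ (signQ-ι n) ⟩
  - ι (-1ℤ ℤ.^ n)           ≡⟨ ι-homo‿- (-1ℤ ℤ.^ n) ⟨
  ι (ℤ.- (-1ℤ ℤ.^ n))       ≡⟨ cong ι (ℤ.-1*i≡-i (-1ℤ ℤ.^ n)) ⟨
  ι (-1ℤ ℤ.^ suc n)         ∎
  where open ≡-Reasoning

rhsSum-*-! : ∀ n → rhsSum n * ι (+ (suc n !)) ≡ ι (scaledRhsSum n)
rhsSum-*-! zero    = refl
rhsSum-*-! (suc n) = begin
  (X + q) * ι (+ (suc (suc n) !))   ≡⟨ cong ((X + q) *_) (trans (cong ι (pos-! (suc n))) (ι-homo-* a P)) ⟩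
  (X + q) * (ι a * ι P)             ≡⟨ distribute X q (ι a) (ι P) ⟩
  X * ι P * ι a + q * ι a * ι P     ≡⟨ cong₂ (λ u v → u * ι a + v * ι P) (rhsSum-*-! n) (/-*-ι (+ suc n) (2 ℕ.+ n)) ⟩
  ι (scaledRhsSum n) * ι a + ι (+ suc n) * ι P   ≡⟨ cong₂ _+_ (ι-homo-* (scaledRhsSum n) a) (ι-homo-* (+ suc n) P) ⟨
  ι (scaledRhsSum n ℤ.* a) + ι (+ suc n ℤ.* P)   ≡⟨ ι-homo-+ (scaledRhsSum n ℤ.* a) (+ suc n ℤ.* P) ⟨
  ι (scaledRhsSum (suc n))          ∎
  where
  open ≡-Reasoning
  X = rhsSum n
  q = + suc n / suc (suc n)
  a = + (2 ℕ.+ n)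
  P = + (suc n !)
  distribute : ∀ X q a P → (X + q) * (a * P) ≡ X * P * a + q * a * P
  distribute = solve 4 (λ X q a P → (X :+ q) :* (a :* P) := X :* P :* a :+ q :* a :* P) refl
    where open ℚ-Solver

integrand-*-! : ∀ m x → integrand (suc m) x * ι (+ ((2 ℕ.+ m) !)) ≡ ι (antiderivative m (+ suc x) ℤ.- antiderivative m (+ x))
integrand-*-! m x = begin
  ι X * B * ι (+ ((2 ℕ.+ m) !))   ≡⟨ cong (λ d → ι X * B * d) (trans (cong ι factorial) (ι-homo-* K P)) ⟩
  ι X * B * (ι K * ι P)           ≡⟨ rearrange (ι X) B (ι K) (ι P) ⟩
  ι K * (ι X * (B * ι P))         ≡⟨ cong (λ y → ι K * (ι X * y)) (/-*-ι F (m !) {{m !≢0}}) ⟩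
  ι K * (ι X * ι F)               ≡⟨ trans (ι-homo-* K (X ℤ.* F)) (cong (ι K *_) (ι-homo-* X F)) ⟨
  ι (K ℤ.* (X ℤ.* F))             ≡⟨ cong ι (antiderivative-Δ m X) ⟨
  ι (antiderivative m (+ suc x) ℤ.- antiderivative m X) ∎
  where
  open ≡-Reasoning
  X = + x
  F = falling (X ℤ.- + 2) m
  B = binom (X ℤ.- + 2) m
  K = + suc m ℤ.* + (2 ℕ.+ m)
  P = + (m !)
  factorial : + ((2 ℕ.+ m) !) ≡ K ℤ.* P
  factorial = begin
    + ((2 ℕ.+ m) !)                          ≡⟨ pos-! (suc m) ⟩
    + (2 ℕ.+ m) ℤ.* + (suc m !)              ≡⟨ cong (+ (2 ℕ.+ m) ℤ.*_) (pos-! m) ⟩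
    + (2 ℕ.+ m) ℤ.* (+ suc m ℤ.* P)          ≡⟨ reassociate (+ (2 ℕ.+ m)) (+ suc m) P ⟩
    K ℤ.* P                                  ∎
    where
    reassociate : ∀ a b c → a ℤ.* (b ℤ.* c) ≡ b ℤ.* a ℤ.* c
    reassociate = solve-∀
  rearrange : ∀ X B K P → X * B * (K * P) ≡ K * (X * (B * P))
  rearrange = solve 4 (λ X B K P → X :* B :* (K :* P) := K :* (X :* (B :* P))) refl
    where open ℚ-Solver

sumBelow-telescope : ∀ (f : ℕ → ℚ) c (U : ℕ → ℤ) → (∀ x → f x * c ≡ ι (U (suc x) ℤ.- U x)) →
                     ∀ M → sumBelow f M * c ≡ ι (U M ℤ.- U 0)
sumBelow-telescope f c U Δ zero    = trans (*-zeroˡ c) (cong ι (sym (ℤ.+-inverseʳ (U 0))))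
sumBelow-telescope f c U Δ (suc M) = begin
  (sumBelow f M + f M) * c                       ≡⟨ *-distribʳ-+ c (sumBelow f M) (f M) ⟩
  sumBelow f M * c + f M * c                     ≡⟨ cong₂ _+_ (sumBelow-telescope f c U Δ M) (Δ M) ⟩
  ι (U M ℤ.- U 0) + ι (U (suc M) ℤ.- U M)        ≡⟨ ι-homo-+ (U M ℤ.- U 0) (U (suc M) ℤ.- U M) ⟨
  ι (U M ℤ.- U 0 ℤ.+ (U (suc M) ℤ.- U M))        ≡⟨ cong ι (cancel (U M) (U 0) (U (suc M))) ⟩
  ι (U (suc M) ℤ.- U 0)                          ∎
  where
  open ≡-Reasoning
  cancel : ∀ a b c → a ℤ.- b ℤ.+ (c ℤ.- a) ≡ c ℤ.- b
  cancel = solve-∀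

-- The Volkenborn integral of Δ U is U′(0): the sum telescopes to U M − U 0 = M · U′(0) + M² · w.
riemannSum-Δ : ∀ (f : ℕ → ℚ) c (U : ℤ → ℤ) {A} L →
               (∀ x → f x * c ≡ ι (U (+ suc x) ℤ.- U (+ x))) → HasSlopeAt U (+ 0) A → L * c ≡ ι A →
               ∀ M .{{_ : NonZero M}} → ∃ λ W → (sumBelow f M * (+ 1 / M) - L) * c ≡ ι (+ M ℤ.* W)
riemannSum-Δ f c U {A} L Δ (slope U′) L*c≡A M = W , (begin
  (S * u - L) * c                          ≡⟨ distribute S u L c ⟩
  S * c * u - L * c                        ≡⟨ cong₂ (λ s l → s * u - l) S*c L*c≡A ⟩
  ι (+ M) * E * u - ι A                    ≡⟨ commute (ι (+ M)) E u (ι A) ⟩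
  u * ι (+ M) * E - ι A                    ≡⟨ cong (λ t → t * E - ι A) (/-*-ι (+ 1) M) ⟩
  1ℚ * E - ι A                             ≡⟨ cancel (ι A) (ι (+ M) * ι W) ⟩
  ι (+ M) * ι W                            ≡⟨ ι-homo-* (+ M) W ⟨
  ι (+ M ℤ.* W)                            ∎)
  where
  open ≡-Reasoning
  S = sumBelow f M
  u = + 1 / M
  W = proj₁ (U′ (+ M))
  E = ι A + ι (+ M) * ι W
  collect : ∀ u m a w → u ℤ.+ m ℤ.* a ℤ.+ m ℤ.* m ℤ.* w ℤ.- u ≡ m ℤ.* (a ℤ.+ m ℤ.* w)
  collect = solve-∀
  S*c : S * c ≡ ι (+ M) * E
  S*c = begin
    S * c                          ≡⟨ sumBelow-telescope f c (λ x → U (+ x)) Δ M ⟩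
    ι (U (+ M) ℤ.- U (+ 0))
      ≡⟨ cong ι (trans (cong (ℤ._- U (+ 0)) (proj₂ (U′ (+ M)))) (collect (U (+ 0)) (+ M) A W)) ⟩
    ι (+ M ℤ.* (A ℤ.+ + M ℤ.* W))
      ≡⟨ ι-homo-* (+ M) (A ℤ.+ + M ℤ.* W) ⟩
    ι (+ M) * ι (A ℤ.+ + M ℤ.* W)
      ≡⟨ cong (ι (+ M) *_) (trans (ι-homo-+ A (+ M ℤ.* W)) (cong (_+_ (ι A)) (ι-homo-* (+ M) W))) ⟩
    ι (+ M) * E ∎
  open ℚ-Solver
  distribute : ∀ S u L c → (S * u - L) * c ≡ S * c * u - L * c
  distribute = solve 4 (λ S u L c → (S :* u :- L) :* c := S :* c :* u :- L :* c) refl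
  commute : ∀ m e u a → m * e * u - a ≡ u * m * e - a
  commute = solve 4 (λ m e u a → m :* e :* u :- a := u :* m :* e :- a) refl
  cancel : ∀ a e → 1ℚ * (a + e) - a ≡ e
  cancel = solve 2 (λ a e → con 1ℚ :* (a :+ e) :- a := e) refl

signQ-*-rhsSum-*-! : ∀ n → signQ n * rhsSum n * ι (+ (suc n !)) ≡ ι (-1ℤ ℤ.^ n ℤ.* scaledRhsSum n)
signQ-*-rhsSum-*-! n = begin
  signQ n * rhsSum n * ι (+ (suc n !))               ≡⟨ *-assoc (signQ n) (rhsSum n) (ι (+ (suc n !))) ⟩
  signQ n * (rhsSum n * ι (+ (suc n !)))             ≡⟨ cong₂ _*_ (signQ-ι n) (rhsSum-*-! n) ⟩
  ι (-1ℤ ℤ.^ n) * ι (scaledRhsSum n)                 ≡⟨ ι-homo-* (-1ℤ ℤ.^ n) (scaledRhsSum n) ⟨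
  ι (-1ℤ ℤ.^ n ℤ.* scaledRhsSum n)                   ∎
  where open ≡-Reasoning

*-ι-cross : ∀ r D Z → r * ι (+ D) ≡ ι Z → ↥ r ℤ.* + D ≡ Z ℤ.* ℚ.↧ r
*-ι-cross r@(ℚ.mkℚ a b _) D Z r*D≡Z =
  trans (sym (ℤ.*-identityʳ (a ℤ.* + D))) (trans (ℚᵘ.drop-*≡* unnormalised) (cong (λ k → Z ℤ.* + suc k) (ℕ.*-identityʳ b)))
  where
  unnormalised : mkℚᵘ a b ℚᵘ.* mkℚᵘ (+ D) 0 ℚᵘ.≃ mkℚᵘ Z 0
  unnormalised = begin
    mkℚᵘ a b ℚᵘ.* mkℚᵘ (+ D) 0      ≈⟨ ℚᵘ.*-cong ℚᵘ.≃-refl (toℚᵘ-ι (+ D)) ⟨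
    toℚᵘ r ℚᵘ.* toℚᵘ (ι (+ D))      ≈⟨ toℚᵘ-homo-* r (ι (+ D)) ⟨
    toℚᵘ (r * ι (+ D))              ≡⟨ cong toℚᵘ r*D≡Z ⟩
    toℚᵘ (ι Z)                      ≈⟨ toℚᵘ-ι Z ⟩
    mkℚᵘ Z 0                        ∎
    where open ℚᵘ.≃-Reasoning

padicValGe-of-*-ι : ∀ {p} → Prime p → ∀ k D .{{_ : NonZero D}} N r → k ℕ.+ D ≤ N →
                    (∃ λ W → r * ι (+ D) ≡ ι (+ (p ^ N) ℤ.* W)) → padicValGe p k r
padicValGe-of-*-ι {p} p-prime k D N r k+D≤N (W , r*D≡pᴺW) =
  ^-+-∣-*-cancel p-prime k ℤ.∣ ↥ r ∣ (∣-trans (^-monoʳ-∣ p k+D≤N) pᴺ∣rD)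
  where
  open ≡-Reasoning
  absolute : p ^ N ℕ.* ℤ.∣ W ∣ ℕ.* ℚ.↧ₙ r ≡ ℤ.∣ ↥ r ∣ ℕ.* D
  absolute = begin
    p ^ N ℕ.* ℤ.∣ W ∣ ℕ.* ℚ.↧ₙ r         ≡⟨ cong (ℕ._* ℚ.↧ₙ r) (ℤ.abs-* (+ (p ^ N)) W) ⟨
    ℤ.∣ + (p ^ N) ℤ.* W ∣ ℕ.* ℚ.↧ₙ r     ≡⟨ ℤ.abs-* (+ (p ^ N) ℤ.* W) (ℚ.↧ r) ⟨
    ℤ.∣ + (p ^ N) ℤ.* W ℤ.* ℚ.↧ r ∣      ≡⟨ cong ℤ.∣_∣ (*-ι-cross r D (+ (p ^ N) ℤ.* W) r*D≡pᴺW) ⟨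
    ℤ.∣ ↥ r ℤ.* + D ∣                    ≡⟨ ℤ.abs-* (↥ r) (+ D) ⟩
    ℤ.∣ ↥ r ∣ ℕ.* D                      ∎
  pᴺ∣rD : p ^ N ∣ ℤ.∣ ↥ r ∣ ℕ.* D
  pᴺ∣rD = subst (p ^ N ∣_) absolute (∣m⇒∣m*n (ℚ.↧ₙ r) (m∣m*n ℤ.∣ W ∣))

volkenbornSum-error : ∀ p pr m N → ∃ λ W →
  (volkenbornSum p pr (integrand (suc m)) N - signQ (suc m) * rhsSum (suc m)) * ι (+ ((2 ℕ.+ m) !)) ≡ ι (+ (p ^ N) ℤ.* W)
volkenbornSum-error p pr m N =
  riemannSum-Δ (integrand (suc m)) (ι (+ ((2 ℕ.+ m) !))) (antiderivative m) (signQ (suc m) * rhsSum (suc m))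
    (integrand-*-! m) (antiderivative-slope m) (signQ-*-rhsSum-*-! (suc m)) (p ^ N) {{m^n≢0 p N {{prime⇒nonZero pr}}}}

mainTheorem11 : (p : ℕ) (pr : Prime p) (n : ℕ) → 1 ≤ n →
    VolkenbornIntegral≡ p pr (integrand n) (signQ n * rhsSum n)
mainTheorem11 p pr (suc m) (ℕ.s≤s ℕ.z≤n) k = suc k ℕ.+ D , λ N k+D≤N →
  padicValGe-of-*-ι pr (suc k) D {{(2 ℕ.+ m) !≢0}} N (error N) k+D≤N (volkenbornSum-error p pr m N)
  where
  D = (2 ℕ.+ m) !
  error : ℕ → ℚ
  error N = volkenbornSum p pr (integrand (suc m)) N - signQ (suc m) * rhsSum (suc m)
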